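{- For every job set $S$ in a three-machine permutation flowshop, a set of Pareto permutations $OptPerm(S)$ of $S$ can be computed as $$OptPerm(S)=MinPerm\big\{\,OptPerm_l(S\setminus\{k\}).k \;:\; k\in S,\ l\in\{1,\dots,|OptPerm(S\setminus\{k\})|\}\,\big\},$$ that is, applying $MinPerm$ to the set of all permutations obtained by appending a job $k\in S$ to a Pareto permutation of $S\setminus\{k\}$ yields a set of Pareto permutations of $S$.
   Context: Three-machine flowshop: each job $i$ has non-negative integer processing times $p_{i1},p_{i2},p_{i3}$ on machines 1, 2, 3, processed in that order; each machine processes one job at a time. A permutation $\pi$ is scheduled from time $0$ as a permutation schedule (same order on all machines, every operation as early as possible); $C^M_j(\pi)$ is the completion time of the last job of $\pi$ on machine $j$, and the criteria vector of $\pi$ is $\langle C^M_2(\pi),C^M_3(\pi)\rangle$. For a set of permutations of a job set, $MinPerm$ returns its Pareto permutations: those whose criteria vector is not dominated by that of another permutation of the set, keeping only one (arbitrary) permutation per criteria vector. $OptPerm(S)$ denotes the Pareto permutations of the set of all permutations of $S$, and $OptPerm_l(S)$ is its $l$-th element under an arbitrary numbering; $OptPerm(\{j\})=\{(j)\}$. For a permutation $\pi$ and a job $k$ not in $\pi$, $\pi.k$ is the permutation obtained by appending $k$ at the end. -}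

module Defs where

open import Data.Nat using (ℕ; _+_; _⊔_; _≤_)
open import Data.Fin using (Fin)
open import Data.Fin.Subset using (Subset; _∈_; _-_)
open import Data.List using (List; []; _∷_; foldl; _∷ʳ_)
open import Data.List.Relation.Unary.Unique.Propositional using (Unique)
import Data.List.Membership.Propositional as LM
open import Data.Product using (_×_; _,_; ∃; proj₁; proj₂)
open import Relation.Binary.PropositionalEquality using (_≡_; _≢_)
open import Relation.Nullary using (¬_)
open import Function.Bundles using (_⇔_)

record Instance (n : ℕ) : Set where
  field
    p₁ p₂ p₃ : Fin n → ℕ
open Instance public

Perm : ℕ → Set
Perm n = List (Fin n)

-- Completion times (C1, C2, C3) of the last scheduled job on machines 1,2,3.
Times : Set
Times = ℕ × ℕ × ℕ

-- Append job k to the permutation schedule (every operation as early as possible).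
step : ∀ {n} → Instance n → Times → Fin n → Times
step I (c₁ , c₂ , c₃) k =
  let d₁ = c₁ + p₁ I k
      d₂ = (c₂ ⊔ d₁) + p₂ I k
      d₃ = (c₃ ⊔ d₂) + p₃ I k
  in d₁ , d₂ , d₃

times : ∀ {n} → Instance n → Perm n → Times
times I π = foldl (step I) (0 , 0 , 0) π

crit : ∀ {n} → Instance n → Perm n → ℕ × ℕ
crit I π = proj₁ (proj₂ (times I π)) , proj₂ (proj₂ (times I π))

Dominates : ℕ × ℕ → ℕ × ℕ → Set
Dominates a b = proj₁ a ≤ proj₁ b × proj₂ a ≤ proj₂ b × a ≢ b

PermSet : ℕ → Set₁
PermSet n = Perm n → Set

Pareto : ∀ {n} → Instance n → PermSet n → Perm n → Set
Pareto I X π = X π × (∀ σ → X σ → ¬ Dominates (crit I σ) (crit I π))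

IsMinPerm : ∀ {n} → Instance n → PermSet n → PermSet n → Set
IsMinPerm I X Y =
  (∀ π → Y π → Pareto I X π) ×
  (∀ π → Pareto I X π → ∃ λ τ → Y τ × crit I τ ≡ crit I π) ×
  (∀ π τ → Y π → Y τ → crit I π ≡ crit I τ → π ≡ τ)

IsPermOf : ∀ {n} → Subset n → Perm n → Set
IsPermOf S π = Unique π × (∀ j → (j ∈ S) ⇔ (j LM.∈ π))

IsOptPerm : ∀ {n} → Instance n → Subset n → PermSet n → Set
IsOptPerm I S Y = IsMinPerm I (IsPermOf S) Y

Candidates : ∀ {n} → Subset n → (Fin n → PermSet n) → PermSet n
Candidates S O π = ∃ λ k → k ∈ S × ∃ λ σ → O k σ × π ≡ σ ∷ʳ k

-- Appending a job k is monotone in the criteria vector among permutations of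
-- the same job set: all of them end machine 1 at the same time (the total
-- machine-1 work), and C₂, C₃ of π.k are monotone in C₂, C₃ of π.  Hence every
-- permutation ρ.k of S is weakly dominated by τ.k, where τ ∈ OptPerm(S - k)
-- has the criteria vector of a Pareto permutation of S - k below ρ.  So the
-- candidates weakly dominate all permutations of S, and MinPerm of a weakly
-- dominating subset is a MinPerm of the whole set.
module Submission where

open import Defs
open import Data.Nat using (ℕ; _+_; _⊔_; _≤_; _<_; _≤?_)
open import Data.Nat.Properties
open import Data.Nat.Induction using (<-wellFounded)
open import Data.Fin using (Fin; zero; suc)
import Data.Fin.Properties as Fin
open import Data.Fin.Subset using (Subset; _∈_; _∉_; _-_; Nonempty; Empty; ∣_∣; ⁅_⁆; inside; outside)
open import Data.Fin.Subset.Properties using (_∈?_; x∈p⇒∣p-x∣<∣p∣; x∈p∧x≢y⇒x∈p-y; p─q⊆p)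
open import Data.List using (List; []; _∷_; _∷ʳ_; initLast; _∷ʳ′_)
open import Data.Vec using ([]; _∷_; here; there)
open import Data.Vec.Properties using (zipWith-identityʳ)
open import Data.List.Properties using (foldl-∷ʳ)
open import Data.List.Relation.Unary.All using ([]; _∷_)
import Data.List.Relation.Unary.All.Properties as All
open import Data.List.Relation.Unary.AllPairs using ([]; _∷_)
open import Data.List.Relation.Unary.Any using (here; there)
open import Data.List.Relation.Unary.Unique.Propositional using (Unique)
import Data.List.Relation.Unary.Unique.Propositional.Properties as Unique
import Data.List.Membership.Propositional as List
open import Data.List.Membership.Propositional.Properties using (∈-++⁺ˡ; ∈-++⁺ʳ; ∈-++⁻)
open import Data.Product using (_×_; _,_; ∃; proj₁; proj₂)
import Data.Product.Properties as Product
open import Data.Sum using (_⊎_; inj₁; inj₂)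
open import Data.Empty using (⊥; ⊥-elim)
open import Function using (_∘′_)
open import Function.Bundles using (mk⇔; Equivalence)
open import Induction.WellFounded as WF using (WellFounded)
import Relation.Binary.Construct.On as On
open import Relation.Binary.PropositionalEquality using (_≡_; _≢_; refl; sym; trans; cong; cong₂; subst; module ≡-Reasoning)
open import Relation.Nullary using (Dec; yes; no; ¬?; contradiction)
open import Relation.Nullary.Decidable using (_×-dec_)
open import Relation.Unary using (_⊆_; Decidable)

open Equivalence

private
  variable
    n : ℕ
    A : Set

x∉p-x : (p : Subset n) (x : Fin n) → x ∉ p - x
x∉p-x (_ ∷ p) (suc x) (there x∈p-x) = x∉p-x p x x∈p-x

x∈p-y⇒x≢y : {p : Subset n} {x y : Fin n} → x ∈ p - y → x ≢ y
x∈p-y⇒x≢y {p = p} {y = y} x∈p-y refl = x∉p-x p y x∈p-y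

x∈p-y⇒x∈p : {p : Subset n} {x y : Fin n} → x ∈ p - y → x ∈ p
x∈p-y⇒x∈p {p = p} {y = y} = p─q⊆p p ⁅ y ⁆

removal-induction : ∀ {ℓ} (P : Subset n → Set ℓ) →
  (∀ T → (∀ k → k ∈ T → P (T - k)) → P T) → ∀ T → P T
removal-induction P step =
  WF.All.wfRec (On.wellFounded ∣_∣ <-wellFounded) _ P
    (λ T rec → step T (λ k k∈T → rec (x∈p⇒∣p-x∣<∣p∣ k∈T)))

sumOver : (Fin n → ℕ) → Subset n → ℕ
sumOver f []            = 0
sumOver f (inside ∷ p)  = f zero + sumOver (λ i → f (suc i)) p
sumOver f (outside ∷ p) = sumOver (λ i → f (suc i)) p

sumOver-Empty : (f : Fin n → ℕ) {p : Subset n} → Empty p → sumOver f p ≡ 0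
sumOver-Empty f {[]}          _ = refl
sumOver-Empty f {inside ∷ p}  e = ⊥-elim (e (zero , here))
sumOver-Empty f {outside ∷ p} e = sumOver-Empty (λ i → f (suc i)) λ (x , x∈p) → e (suc x , there x∈p)

sumOver-remove : (f : Fin n → ℕ) (p : Subset n) {k : Fin n} → k ∈ p →
  sumOver f (p - k) + f k ≡ sumOver f p
-- The tail of (inside ∷ p) - zero is p ─ ⊥ with a different instance of the
-- local `diff` of _─_, so p─⊥≡p does not apply.
sumOver-remove f (inside ∷ p) {zero} here =
  trans (cong (λ q → sumOver (λ i → f (suc i)) q + f zero) (zipWith-identityʳ (λ _ → refl) p))
        (+-comm (sumOver (λ i → f (suc i)) p) (f zero))
sumOver-remove f (inside ∷ p) {suc k} (there k∈p) =
  trans (+-assoc (f zero) _ (f (suc k))) (cong (f zero +_) (sumOver-remove (λ i → f (suc i)) p k∈p))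
sumOver-remove f (outside ∷ p) {suc k} (there k∈p) = sumOver-remove (λ i → f (suc i)) p k∈p

Unique-∷ʳ⁺ : ∀ {xs : List A} {k} → Unique xs → k List.∉ xs → Unique (xs ∷ʳ k)
Unique-∷ʳ⁺ u k∉xs = Unique.++⁺ u ([] ∷ []) λ { (x∈xs , here refl) → k∉xs x∈xs }

Unique-∷ʳ⁻ : ∀ (xs : List A) {k} → Unique (xs ∷ʳ k) → Unique xs × k List.∉ xs
Unique-∷ʳ⁻ []       u = [] , λ ()
Unique-∷ʳ⁻ (x ∷ xs) (x∉ ∷ u) with Unique-∷ʳ⁻ xs u | All.++⁻ʳ xs x∉
... | u′ , k∉xs | x≢k ∷ [] =
  All.++⁻ˡ xs x∉ ∷ u′ , λ { (here refl) → x≢k refl ; (there k∈xs) → k∉xs k∈xs }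

∈-∷ʳ⁻ : ∀ (xs : List A) {k v} → v List.∈ xs ∷ʳ k → v List.∈ xs ⊎ v ≡ k
∈-∷ʳ⁻ xs v∈ with ∈-++⁻ xs v∈
... | inj₁ v∈xs       = inj₁ v∈xs
... | inj₂ (here v≡k) = inj₂ v≡k

IsPermOf-[]⁺ : {T : Subset n} → Empty T → IsPermOf T []
IsPermOf-[]⁺ e = [] , λ j → mk⇔ (λ j∈T → ⊥-elim (e (j , j∈T))) (λ ())

IsPermOf-[]⁻ : {T : Subset n} → IsPermOf T [] → Empty T
IsPermOf-[]⁻ (_ , mem) (j , j∈T) with to (mem j) j∈T
... | ()

IsPermOf-∷ʳ⁺ : {T : Subset n} {k : Fin n} {σ : Perm n} →
  k ∈ T → IsPermOf (T - k) σ → IsPermOf T (σ ∷ʳ k)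
IsPermOf-∷ʳ⁺ {T = T} {k} {σ} k∈T (u , mem) =
  Unique-∷ʳ⁺ u (λ k∈σ → x∉p-x T k (from (mem k) k∈σ)) , λ j → mk⇔ (into j) (outof j)
  where
  into : ∀ j → j ∈ T → j List.∈ σ ∷ʳ k
  into j j∈T with j Fin.≟ k
  ... | yes refl = ∈-++⁺ʳ σ (here refl)
  ... | no j≢k   = ∈-++⁺ˡ (to (mem j) (x∈p∧x≢y⇒x∈p-y j∈T j≢k))
  outof : ∀ j → j List.∈ σ ∷ʳ k → j ∈ T
  outof j j∈ with ∈-∷ʳ⁻ σ j∈
  ... | inj₁ j∈σ = x∈p-y⇒x∈p (from (mem j) j∈σ)
  ... | inj₂ refl = k∈T

IsPermOf-∷ʳ⁻ : {T : Subset n} {k : Fin n} (σ : Perm n) →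
  IsPermOf T (σ ∷ʳ k) → k ∈ T × IsPermOf (T - k) σ
IsPermOf-∷ʳ⁻ {T = T} {k} σ (u , mem) =
  from (mem k) (∈-++⁺ʳ σ (here refl)) , u′ , λ j → mk⇔ (into j) (outof j)
  where
  u′ : Unique σ
  u′ = proj₁ (Unique-∷ʳ⁻ σ u)
  k∉σ : k List.∉ σ
  k∉σ = proj₂ (Unique-∷ʳ⁻ σ u)
  into : ∀ j → j ∈ T - k → j List.∈ σ
  into j j∈ with ∈-∷ʳ⁻ σ (to (mem j) (x∈p-y⇒x∈p j∈))
  ... | inj₁ j∈σ = j∈σ
  ... | inj₂ j≡k = ⊥-elim (x∈p-y⇒x≢y j∈ j≡k)
  outof : ∀ j → j List.∈ σ → j ∈ T - k
  outof j j∈σ = x∈p∧x≢y⇒x∈p-y (from (mem j) (∈-++⁺ˡ j∈σ)) λ { refl → k∉σ j∈σ }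

data PermView {n} (T : Subset n) : Perm n → Set where
  empty : Empty T → PermView T []
  snoc  : ∀ {σ k} → k ∈ T → IsPermOf (T - k) σ → PermView T (σ ∷ʳ k)

permView : {T : Subset n} (π : Perm n) → IsPermOf T π → PermView T π
permView π h with initLast π
... | []      = empty (IsPermOf-[]⁻ h)
... | σ ∷ʳ′ k = let k∈T , hσ = IsPermOf-∷ʳ⁻ σ h in snoc k∈T hσ

∃-IsPermOf? : (T : Subset n) (Q : Perm n → Set) → Decidable Q → Dec (∃ λ π → IsPermOf T π × Q π)
∃-IsPermOf? {n} = removal-induction Decider decide
  where
  Decider : Subset n → Set₁
  Decider T = (Q : Perm n → Set) → Decidable Q → Dec (∃ λ π → IsPermOf T π × Q π)

  decide : ∀ T → (∀ k → k ∈ T → Decider (T - k)) → Decider T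
  decide T rec Q Q? with Fin.all? (λ j → ¬? (j ∈? T)) ×-dec Q? [] | Fin.any? lastJob?
    where
    lastJob? : ∀ k → Dec (k ∈ T × ∃ λ σ → IsPermOf (T - k) σ × Q (σ ∷ʳ k))
    lastJob? k with k ∈? T
    ... | no k∉T = no (k∉T ∘′ proj₁)
    ... | yes k∈T with rec k k∈T (λ σ → Q (σ ∷ʳ k)) (λ σ → Q? (σ ∷ʳ k))
    ...   | yes found = yes (k∈T , found)
    ...   | no none   = no (none ∘′ proj₂)
  ... | yes (e , q) | _ = yes ([] , IsPermOf-[]⁺ (λ (j , j∈T) → e j j∈T) , q)
  ... | no _ | yes (k , k∈T , σ , hσ , q) = yes (σ ∷ʳ k , IsPermOf-∷ʳ⁺ k∈T hσ , q)
  ... | no no[] | no no∷ʳ = no λ (π , h , q) → refute π h q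
    where
    refute : ∀ π → IsPermOf T π → Q π → ⊥
    refute π h q with permView π h
    ... | empty e     = no[] ((λ j j∈T → e (j , j∈T)) , q)
    ... | snoc k∈T hσ = no∷ʳ (_ , k∈T , _ , hσ , q)

_≤²_ : ℕ × ℕ → ℕ × ℕ → Set
(a₁ , a₂) ≤² (b₁ , b₂) = a₁ ≤ b₁ × a₂ ≤ b₂

≤²-trans : ∀ {a b c} → a ≤² b → b ≤² c → a ≤² c
≤²-trans (a₁≤b₁ , a₂≤b₂) (b₁≤c₁ , b₂≤c₂) = ≤-trans a₁≤b₁ b₁≤c₁ , ≤-trans a₂≤b₂ b₂≤c₂

Dominates⇒≤² : ∀ {a b} → Dominates a b → a ≤² b
Dominates⇒≤² (a₁≤b₁ , a₂≤b₂ , _) = a₁≤b₁ , a₂≤b₂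

≤²-Dominates-trans : ∀ {a b c} → a ≤² b → Dominates b c → Dominates a c
≤²-Dominates-trans (a₁≤b₁ , a₂≤b₂) (b₁≤c₁ , b₂≤c₂ , b≢c) =
  ≤-trans a₁≤b₁ b₁≤c₁ , ≤-trans a₂≤b₂ b₂≤c₂ , λ { refl →
    b≢c (cong₂ _,_ (≤-antisym b₁≤c₁ a₁≤b₁) (≤-antisym b₂≤c₂ a₂≤b₂)) }

≤²∧≢⇒Dominates : ∀ {a b} → a ≤² b → a ≢ b → Dominates a b
≤²∧≢⇒Dominates (a₁≤b₁ , a₂≤b₂) a≢b = a₁≤b₁ , a₂≤b₂ , a≢b

dominates? : ∀ a b → Dec (Dominates a b)
dominates? (a₁ , a₂) (b₁ , b₂) =
  (a₁ ≤? b₁) ×-dec (a₂ ≤? b₂) ×-dec ¬? (Product.≡-dec _≟_ _≟_ (a₁ , a₂) (b₁ , b₂))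

Dominates⇒+< : ∀ {a₁ a₂ b₁ b₂} → Dominates (a₁ , a₂) (b₁ , b₂) → a₁ + a₂ < b₁ + b₂
Dominates⇒+< (a₁≤b₁ , a₂≤b₂ , a≢b) with m≤n⇒m<n∨m≡n a₁≤b₁ | m≤n⇒m<n∨m≡n a₂≤b₂
... | inj₁ a₁<b₁ | _          = +-mono-<-≤ a₁<b₁ a₂≤b₂
... | inj₂ _     | inj₁ a₂<b₂ = +-mono-≤-< a₁≤b₁ a₂<b₂
... | inj₂ refl  | inj₂ refl  = contradiction refl a≢b

module _ {n} (I : Instance n) where

  WeaklyDominatedBy : PermSet n → PermSet n → Set
  WeaklyDominatedBy X C = ∀ {ρ} → X ρ → ∃ λ c → C c × crit I c ≤² crit I ρ

  -- Well-founded because domination strictly decreases the sum of the two criteria.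
  Pareto-below : {X : PermSet n} →
    (∀ ρ → Dec (∃ λ σ → X σ × Dominates (crit I σ) (crit I ρ))) →
    WeaklyDominatedBy X (Pareto I X)
  Pareto-below {X} dominated? {ρ} = WF.All.wfRec wf _ Goal below ρ
    where
    weight : Perm n → ℕ
    weight π = proj₁ (crit I π) + proj₂ (crit I π)
    wf : WellFounded (λ σ τ → weight σ < weight τ)
    wf = On.wellFounded weight <-wellFounded
    Goal : Perm n → Set
    Goal ρ = X ρ → ∃ λ τ → Pareto I X τ × crit I τ ≤² crit I ρ
    below : ∀ ρ → (∀ {σ} → weight σ < weight ρ → Goal σ) → Goal ρ
    below ρ rec Xρ with dominated? ρ
    ... | no undominated = ρ , (Xρ , λ σ Xσ σ≻ρ → undominated (σ , Xσ , σ≻ρ)) , ≤-refl , ≤-refl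
    ... | yes (σ , Xσ , σ≻ρ) =
      let τ , τ-pareto , τ≤σ = rec (Dominates⇒+< σ≻ρ) Xσ
      in τ , τ-pareto , ≤²-trans τ≤σ (Dominates⇒≤² σ≻ρ)

  IsMinPerm-of-WeaklyDominatedBy : {X C Y : PermSet n} → C ⊆ X → WeaklyDominatedBy X C →
    IsMinPerm I C Y → IsMinPerm I X Y
  IsMinPerm-of-WeaklyDominatedBy {X} {C} {Y} C⊆X X≤C (Y-pareto , Y-complete , Y-unique) =
    X-pareto , X-complete , Y-unique
    where
    X-pareto : ∀ π → Y π → Pareto I X π
    X-pareto π Yπ =
      let Cπ , π-undominated = Y-pareto π Yπ
      in C⊆X Cπ , λ σ Xσ σ≻π →
        let c , Cc , c≤σ = X≤C Xσ in π-undominated c Cc (≤²-Dominates-trans c≤σ σ≻π)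
    X-complete : ∀ π → Pareto I X π → ∃ λ τ → Y τ × crit I τ ≡ crit I π
    X-complete π (Xπ , π-undominated) with X≤C Xπ
    ... | c , Cc , c≤π with Product.≡-dec _≟_ _≟_ (crit I c) (crit I π)
    ... | no c≢π = contradiction (≤²∧≢⇒Dominates c≤π c≢π) (π-undominated c (C⊆X Cc))
    ... | yes c≡π =
      let c-pareto = Cc , λ σ Cσ σ≻c → π-undominated σ (C⊆X Cσ) (subst (Dominates _) c≡π σ≻c)
          τ , Yτ , τ≡c = Y-complete c c-pareto
      in τ , Yτ , trans τ≡c c≡π

  C₁ : Perm n → ℕ
  C₁ π = proj₁ (times I π)

  times-∷ʳ : ∀ (π : Perm n) k → times I (π ∷ʳ k) ≡ step I (times I π) k
  times-∷ʳ π k = foldl-∷ʳ (step I) (0 , 0 , 0) k π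

  step-mono : ∀ (t t′ : Times) k → proj₁ t ≡ proj₁ t′ → proj₂ t ≤² proj₂ t′ →
    proj₂ (step I t k) ≤² proj₂ (step I t′ k)
  step-mono (c₁ , c₂ , _) (.c₁ , c₂′ , _) k refl (c₂≤c₂′ , c₃≤c₃′) =
    d₂≤d₂′ , +-monoˡ-≤ (p₃ I k) (⊔-mono-≤ c₃≤c₃′ d₂≤d₂′)
    where
    d₂≤d₂′ : (c₂ ⊔ (c₁ + p₁ I k)) + p₂ I k ≤ (c₂′ ⊔ (c₁ + p₁ I k)) + p₂ I k
    d₂≤d₂′ = +-monoˡ-≤ (p₂ I k) (⊔-monoˡ-≤ (c₁ + p₁ I k) c₂≤c₂′)

  crit-∷ʳ-mono : ∀ (σ τ : Perm n) k → C₁ τ ≡ C₁ σ → crit I τ ≤² crit I σ →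
    crit I (τ ∷ʳ k) ≤² crit I (σ ∷ʳ k)
  crit-∷ʳ-mono σ τ k C₁τ≡C₁σ τ≤σ
    rewrite times-∷ʳ τ k | times-∷ʳ σ k = step-mono (times I τ) (times I σ) k C₁τ≡C₁σ τ≤σ

  C₁-IsPermOf : (T : Subset n) {π : Perm n} → IsPermOf T π → C₁ π ≡ sumOver (p₁ I) T
  C₁-IsPermOf = removal-induction (λ T → ∀ {π} → IsPermOf T π → C₁ π ≡ sumOver (p₁ I) T) total
    where
    total : ∀ T → (∀ k → k ∈ T → ∀ {σ} → IsPermOf (T - k) σ → C₁ σ ≡ sumOver (p₁ I) (T - k)) →
      ∀ {π} → IsPermOf T π → C₁ π ≡ sumOver (p₁ I) T
    total T rec {π} h with permView π h
    ... | empty e = sym (sumOver-Empty (p₁ I) e)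
    ... | snoc {σ} {k} k∈T hσ = begin
      C₁ (σ ∷ʳ k)                        ≡⟨ cong proj₁ (times-∷ʳ σ k) ⟩
      C₁ σ + p₁ I k                      ≡⟨ cong (_+ p₁ I k) (rec k k∈T hσ) ⟩
      sumOver (p₁ I) (T - k) + p₁ I k    ≡⟨ sumOver-remove (p₁ I) T k∈T ⟩
      sumOver (p₁ I) T                   ∎
      where open ≡-Reasoning

  C₁-IsPermOf-≡ : (T : Subset n) {σ τ : Perm n} → IsPermOf T σ → IsPermOf T τ → C₁ σ ≡ C₁ τ
  C₁-IsPermOf-≡ T hσ hτ = trans (C₁-IsPermOf T hσ) (sym (C₁-IsPermOf T hτ))

  Pareto-IsPermOf-below : (T : Subset n) → WeaklyDominatedBy (IsPermOf T) (Pareto I (IsPermOf T))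
  Pareto-IsPermOf-below T = Pareto-below λ ρ → ∃-IsPermOf? T _ λ σ → dominates? (crit I σ) (crit I ρ)

  module _ (S : Subset n) (O : Fin n → PermSet n) (O-opt : ∀ k → k ∈ S → IsOptPerm I (S - k) (O k)) where

    Candidates⊆IsPermOf : Candidates S O ⊆ IsPermOf S
    Candidates⊆IsPermOf (k , k∈S , σ , Oσ , refl) = IsPermOf-∷ʳ⁺ k∈S (proj₁ (proj₁ (O-opt k k∈S) σ Oσ))

    IsPermOf-WeaklyDominatedBy-Candidates : Nonempty S → WeaklyDominatedBy (IsPermOf S) (Candidates S O)
    IsPermOf-WeaklyDominatedBy-Candidates S≢∅ {ρ} h with permView ρ h
    ... | empty e = contradiction S≢∅ e
    ... | snoc {ρ′} {k} k∈S hρ′ =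
      let O-pareto , O-complete , _ = O-opt k k∈S
          τ′ , τ′-pareto , τ′≤ρ′ = Pareto-IsPermOf-below (S - k) hρ′
          τ , Oτ , τ≡τ′ = O-complete τ′ τ′-pareto
          hτ = proj₁ (O-pareto τ Oτ)
          τ≤ρ′ = subst (_≤² crit I ρ′) (sym τ≡τ′) τ′≤ρ′
      in τ ∷ʳ k , (k , k∈S , τ , Oτ , refl) , crit-∷ʳ-mono ρ′ τ k (C₁-IsPermOf-≡ (S - k) hτ hρ′) τ≤ρ′

theorem2p2 : ∀ {n} (I : Instance n) (S : Subset n) → Nonempty S →
    (O : Fin n → PermSet n) →
    (∀ k → k ∈ S → IsOptPerm I (S - k) (O k)) →
    (Y : PermSet n) → IsMinPerm I (Candidates S O) Y →
    IsOptPerm I S Y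
theorem2p2 I S S≢∅ O O-opt Y =
  IsMinPerm-of-WeaklyDominatedBy I
    (Candidates⊆IsPermOf I S O O-opt)
    (IsPermOf-WeaklyDominatedBy-Candidates I S O O-opt S≢∅)
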